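{- There is an absolute constant $C_5>0$ such that the following holds. Let $M$ be either a quadratic or an abelian cubic extension of $\mathbb{Q}$, with conductor $f$, and let $v=2^4\cdot3^3\prod_{\ell\mid f,\ \ell>3}\ell$. Let $u$ be an integer coprime to $v$ such that (1) every prime $p\equiv u\pmod v$ is inert in $M$, and (2) the largest power $T$ of $2$ dividing $u-1$ lies in $\{2,4,8\}$ and $\gcd(\frac{u-1}{T},v)=1$. Let $\kappa$ be a natural number. Then there are integers $a_1<\dots<a_\kappa$, each congruent to $u$ modulo $v$, such that the $2\kappa$ linear functions \[ L_i(n)=vn+a_i,\qquad \tilde L_i(n)=\frac{v}{T}n+\frac{a_i-1}{T}\qquad(1\le i\le\kappa) \] form an admissible family, and $a_\kappa-a_1\le v\cdot(2\kappa)^{C_5}$.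
   Context: A finite set of distinct linear functions $L_j(n)=\alpha_j n+\beta_j$ with $\alpha_j,\beta_j\in\mathbb{Z}$ and $\alpha_j>0$ is admissible if for every prime $p$ there is an integer $n_p$ with $p\nmid\prod_j L_j(n_p)$. -}

module Defs where

open import Data.Nat as ℕ using (ℕ; zero; suc; NonZero)
open import Data.Nat.Primality using (Prime; prime?)
open import Data.Nat.Divisibility as ℕD using (_∣?_)
open import Data.Integer as ℤ using (ℤ; +_; _+_; _-_; _*_; _<_; 0ℤ; 1ℤ)
open import Data.Integer.Divisibility as ℤD using ()
open import Data.Integer.DivMod using (_/ℕ_)
open import Data.Nat.ListAction as ℕLA using ()
open import Data.List as List using (List; []; _∷_; _++_; map; filter; upTo; tabulate)
open import Data.List.Relation.Unary.All using (All)
open import Data.List.Relation.Unary.Unique.Propositional using (Unique)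
open import Data.Fin using (Fin)
open import Data.Product using (_×_; _,_; proj₁; ∃)
open import Relation.Nullary using (¬_; _×-dec_)

LinFun : Set
LinFun = ℤ × ℤ

eval : LinFun → ℤ → ℤ
eval (α , β) n = α * n + β

productℤ : List ℤ → ℤ
productℤ = List.foldr _*_ 1ℤ

Admissible : List LinFun → Set
Admissible Ls =
  Unique Ls
  × All (λ L → 0ℤ < proj₁ L) Ls
  × (∀ (p : ℕ) → Prime p →
       ∃ λ (n : ℤ) → ¬ ((+ p) ℤD.∣ productℤ (map (λ L → eval L n) Ls)))

_≡_[mod_] : ℤ → ℤ → ℕ → Set
a ≡ b [mod v ] = (+ v) ℤD.∣ (a - b)

-- ∏_{ℓ ∣ f, ℓ > 3, ℓ prime} ℓ   (for f ≥ 1 every such ℓ is ≤ f)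
oddRad : ℕ → ℕ
oddRad f =
  ℕLA.product
    (filter (λ ℓ → prime? ℓ ×-dec (ℓ ∣? f) ×-dec (4 ℕ.≤? ℓ)) (upTo (suc f)))

modulusV : ℕ → ℕ
modulusV f = 16 ℕ.* 27 ℕ.* oddRad f

family : (v T : ℕ) .{{_ : NonZero T}} (κ : ℕ) → (Fin κ → ℤ) → List LinFun
family v T κ a =
  tabulate (λ i → (+ v , a i))
  ++ tabulate (λ i → (+ (v ℕ./ T) , ((a i - 1ℤ) /ℕ T)))

-- Take a_i = u + 5 v i² and write v = T W, u − 1 = T q, so that L̃_i(n) = W n + q + 5 W i² and
-- T L̃_i = L_i − 1; then a_κ − a_1 ≤ 5 v κ² ≤ v (2κ)³. A prime p dividing v also divides W, and at
-- n = 0 the values are ≡ u resp. ≡ q (mod p), both prime to v. For p ∤ v it suffices to find a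
-- residue r with r ≢ −E y² and r ≢ 1 − E y² (mod p) for all y, where E = 5 v, and to solve
-- v n ≡ r − u. If p ∣ E (that is, p = 5) then r = 2 works. Otherwise p ≥ 7; if every residue
-- were of the form t − E y² with 0 ≤ y ≤ (p − 1)/2 and t ∈ {0, 1}, choosing t = 0 whenever
-- possible would give an injection from the p residues into these p + 1 pairs (y, t). It misses
-- every pair (b, 1) with 1 − E b² ≡ −E a², and solving b² − a² ≡ 1/E with b − a = 1, 2, 3
-- yields two such pairs with different b: a contradiction.

module Submission where

open import Defs
open import Data.Nat as ℕ using (ℕ; suc; NonZero; _^_)
open import Data.Nat.Coprimality using (Coprime)
open import Data.Integer as ℤ using (ℤ; +_; _-_; _<_; _≤_; ∣_∣; 1ℤ)
open import Data.Integer.Divisibility as ℤD using ()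
open import Data.Integer.DivMod using (_/ℕ_)
open import Data.Fin as Fin using (Fin)
open import Data.Product using (_×_; _,_; ∃)
open import Data.Sum using (_⊎_)
open import Relation.Nullary using (¬_)
open import Relation.Binary.PropositionalEquality using (_≡_)

open import Data.Empty using (⊥; ⊥-elim)
open import Data.Fin using (toℕ)
open import Data.Fin.Patterns using (0F; 1F)
import Data.Fin.Properties as Fin
open import Data.Integer using (_+_; _*_; -_; 0ℤ; -1ℤ)
open import Data.Integer.DivMod using (_%ℕ_; a≡a%ℕn+[a/ℕn]*n; n%ℕd<d)
import Data.Integer.Divisibility.Signed as ℤ∣
import Data.Integer.Properties as ℤ
open import Data.Integer.Tactic.RingSolver using (solve-∀)
open import Data.List as List using (List; _++_)
open import Data.List.Membership.Propositional using (_∈_)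
import Data.List.Properties as List
open import Data.List.Relation.Unary.All as All using (All; []; _∷_)
import Data.List.Relation.Unary.All.Properties as All
import Data.List.Relation.Unary.Any.Properties as Any
open import Data.List.Relation.Unary.Unique.Propositional using (Unique)
import Data.List.Relation.Unary.Unique.Propositional.Properties as Unique
open import Data.Nat using (zero; z≤n; s≤s; _∸_; _⊔_)
open import Data.Nat.Coprimality using (coprime-Bézout)
open import Data.Nat.DivMod using (_%_; _/_; m≡m%n+[m/n]*n; m%n<n; m*n/n≡m)
open import Data.Nat.Divisibility
  using (_∣_; _∤_; _∣?_; divides; ∣-refl; ∣-trans; ∣1⇒≡1; >⇒∤; m∣m*n; ∣m⇒∣m*n; *-monoʳ-∣)
import Data.Nat.GCD as GCD
open import Data.Nat.Primality
  using (Prime; prime?; euclidsLemma; prime⇒irreducible; ¬prime[1]; productOfPrimes≥1)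
import Data.Nat.Properties as ℕ
open import Data.Nat.Tactic.RingSolver using () renaming (solve-∀ to ℕ-solve-∀)
open import Data.Product using (∃₂; proj₁; proj₂; uncurry; map₂)
open import Data.Sum using (inj₁; inj₂)
open import Function using (_∘_; Injective)
open import Relation.Binary.Definitions using (tri<; tri≈; tri>)
open import Relation.Binary.PropositionalEquality
  using (_≢_; refl; sym; trans; cong; cong₂; subst; subst₂; module ≡-Reasoning)
open import Relation.Nullary using (Dec; yes; no; _×-dec_)

private variable
  p m n : ℕ
  x y z : ℤ

-- Divisibility of integers by natural numbers

infix 4 _∣ℤ_

_∣ℤ_ : ℕ → ℤ → Set
p ∣ℤ z = + p ℤ∣.∣ z

∣ℤ⇒∣ : p ∣ℤ + m → p ∣ m
∣ℤ⇒∣ = ℤ∣.∣⇒∣ᵤ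

∣⇒∣ℤ : p ∣ m → p ∣ℤ + m
∣⇒∣ℤ = ℤ∣.∣ᵤ⇒∣

∣ℤ-multiple : ∀ a → p ∣ℤ x → z ≡ a * x → p ∣ℤ z
∣ℤ-multiple a p∣x refl = ℤ∣.∣n⇒∣m*n a p∣x

∣ℤ-combination : ∀ a b → p ∣ℤ x → p ∣ℤ y → z ≡ a * x + b * y → p ∣ℤ z
∣ℤ-combination a b p∣x p∣y refl = ℤ∣.∣m∣n⇒∣m+n (ℤ∣.∣n⇒∣m*n a p∣x) (ℤ∣.∣n⇒∣m*n b p∣y)

∣ℤ-combination₃ : ∀ {w} a b c → p ∣ℤ x → p ∣ℤ y → p ∣ℤ z → w ≡ a * x + b * y + c * z → p ∣ℤ w
∣ℤ-combination₃ a b c p∣x p∣y p∣z refl =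
  ℤ∣.∣m∣n⇒∣m+n (∣ℤ-combination a b p∣x p∣y refl) (ℤ∣.∣n⇒∣m*n c p∣z)

∤-divisor : p ∤ n → m ∣ n → p ∤ m
∤-divisor p∤n m∣n p∣m = p∤n (∣-trans p∣m m∣n)

prime∤1 : Prime p → p ∤ 1
prime∤1 p-prime p∣1 = ¬prime[1] (subst Prime (∣1⇒≡1 p∣1) p-prime)

prime∤2⇒odd : Prime p → p ∤ 2 → ∃ λ h → p ≡ suc (2 ℕ.* h)
prime∤2⇒odd {p} p-prime p∤2 with p % 2 | m≡m%n+[m/n]*n p 2 | m%n<n p 2
... | 0 | p≡[p/2]*2 | _ with prime⇒irreducible p-prime (divides (p / 2) p≡[p/2]*2)
...   | inj₂ 2≡p = ⊥-elim (p∤2 (subst (_∣ 2) 2≡p ∣-refl))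
prime∤2⇒odd {p} _ _ | 1 | p≡1+[p/2]*2 | _ = p / 2 , trans p≡1+[p/2]*2 (cong suc (ℕ.*-comm (p / 2) 2))
prime∤2⇒odd {p} _ _ | suc (suc _) | _ | s≤s (s≤s ())

prime∤*⇒∤ : Prime p → ¬ p ∣ℤ x → ¬ p ∣ℤ y → ¬ p ∣ℤ x * y
prime∤*⇒∤ {p} {x} {y} p-prime p∤x p∤y p∣xy
  with euclidsLemma ∣ x ∣ ∣ y ∣ p-prime (subst (p ∣_) (ℤ.abs-* x y) (ℤ∣.∣⇒∣ᵤ p∣xy))
... | inj₁ p∣x = p∤x (ℤ∣.∣ᵤ⇒∣ p∣x)
... | inj₂ p∣y = p∤y (ℤ∣.∣ᵤ⇒∣ p∣y)

prime∤productℤ : Prime p → {zs : List ℤ} → All (λ z → ¬ p ∣ℤ z) zs → ¬ p ∣ℤ productℤ zs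
prime∤productℤ p-prime []           = prime∤1 p-prime ∘ ∣ℤ⇒∣
prime∤productℤ p-prime (p∤z ∷ p∤zs) = prime∤*⇒∤ p-prime p∤z (prime∤productℤ p-prime p∤zs)

prime∣^⇒∣ : ∀ k → Prime p → p ∣ m ^ k → p ∣ m
prime∣^⇒∣ zero    p-prime p∣1 = ⊥-elim (prime∤1 p-prime p∣1)
prime∣^⇒∣ {m = m} (suc k) p-prime p∣m*m^k with euclidsLemma m (m ^ k) p-prime p∣m*m^k
... | inj₁ p∣m   = p∣m
... | inj₂ p∣m^k = prime∣^⇒∣ k p-prime p∣m^k

prime∣⇒∣cofactor : ∀ {v T W k} → v ≡ T ℕ.* W → T ∣ 2 ^ k → 2 ∣ W → Prime p → p ∣ v → p ∣ W
prime∣⇒∣cofactor {T = T} {W} {k} refl T∣2^k 2∣W p-prime p∣TW with euclidsLemma T W p-prime p∣TW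
... | inj₁ p∣T = ∣-trans (prime∣^⇒∣ k p-prime (∣-trans p∣T T∣2^k)) 2∣W
... | inj₂ p∣W = p∣W

coprime⇒∤ : Coprime m n → Prime p → p ∣ n → p ∤ m
coprime⇒∤ m⊥n p-prime p∣n p∣m = ¬prime[1] (subst Prime (m⊥n (p∣m , p∣n)) p-prime)

prime∤⇒coprime : Prime p → p ∤ m → Coprime m p
prime∤⇒coprime p-prime p∤m (d∣m , d∣p) with prime⇒irreducible p-prime d∣p
... | inj₁ d≡1  = d≡1
... | inj₂ refl = ⊥-elim (p∤m d∣m)

∣∧<⇒≡0 : n ∣ m → m ℕ.< n → m ≡ 0
∣∧<⇒≡0 {m = zero}  _   _   = refl
∣∧<⇒≡0 {m = suc _} n∣m m<n = ⊥-elim (>⇒∤ m<n n∣m)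

∣ℤ-toℕ-toℕ⇒≡ : (i j : Fin n) → n ∣ℤ + toℕ i - + toℕ j → i ≡ j
∣ℤ-toℕ-toℕ⇒≡ {n} i j n∣i-j = Fin.toℕ-injective (ℤ.+-injective (ℤ.i-j≡0⇒i≡j _ _ i-j≡0))
  where
  ∣i-j∣<n : ∣ + toℕ i - + toℕ j ∣ ℕ.< n
  ∣i-j∣<n = ℕ.≤-<-trans
    (subst (ℕ._≤ toℕ i ⊔ toℕ j) (cong ∣_∣ (sym (ℤ.m-n≡m⊖n (toℕ i) (toℕ j))))
           (ℤ.∣m⊝n∣≤m⊔n (toℕ i) (toℕ j)))
    (ℕ.⊔-lub (Fin.toℕ<n i) (Fin.toℕ<n j))
  i-j≡0 : + toℕ i - + toℕ j ≡ 0ℤ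
  i-j≡0 = ℤ.∣i∣≡0⇒i≡0 (∣∧<⇒≡0 (ℤ∣.∣⇒∣ᵤ n∣i-j) ∣i-j∣<n)

/ℕ-exact : ∀ z T .{{_ : NonZero T}} → T ∣ℤ z → z ≡ (z /ℕ T) * + T
/ℕ-exact z T T∣z = begin
  z                               ≡⟨ z≡r+qT ⟩
  + (z %ℕ T) + (z /ℕ T) * + T     ≡⟨ cong (λ r → + r + (z /ℕ T) * + T) r≡0 ⟩
  0ℤ + (z /ℕ T) * + T             ≡⟨ ℤ.+-identityˡ _ ⟩
  (z /ℕ T) * + T                  ∎
  where
  open ≡-Reasoning
  z≡r+qT : z ≡ + (z %ℕ T) + (z /ℕ T) * + T
  z≡r+qT = a≡a%ℕn+[a/ℕn]*n z T
  r≡r+x-x : ∀ r x → r ≡ r + x - x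
  r≡r+x-x = solve-∀
  r≡z-qT : + (z %ℕ T) ≡ z - (z /ℕ T) * + T
  r≡z-qT = trans (r≡r+x-x (+ (z %ℕ T)) ((z /ℕ T) * + T)) (cong (_- (z /ℕ T) * + T) (sym z≡r+qT))
  r≡0 : z %ℕ T ≡ 0
  r≡0 = ∣∧<⇒≡0 (∣ℤ⇒∣ (subst (T ∣ℤ_) (sym r≡z-qT) (ℤ∣.∣m∣n⇒∣m-n T∣z (ℤ∣.∣n⇒∣m*n (z /ℕ T) ℤ∣.∣-refl))))
               (n%ℕd<d z T)

*-/ℕ-cancel : ∀ k T .{{_ : NonZero T}} → (k * + T) /ℕ T ≡ k
*-/ℕ-cancel k T = sym (ℤ.*-cancelʳ-≡ k ((k * + T) /ℕ T) (+ T) (/ℕ-exact (k * + T) T (ℤ∣.divides k refl)))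

pos-1+* : ∀ a b c d → 1 ℕ.+ a ℕ.* b ≡ c ℕ.* d → 1ℤ + + a * + b ≡ + c * + d
pos-1+* a b c d eq = begin
  1ℤ + + a * + b       ≡⟨ cong (λ w → 1ℤ + w) (ℤ.pos-* a b) ⟨
  + (1 ℕ.+ a ℕ.* b)    ≡⟨ cong +_ eq ⟩
  + (c ℕ.* d)          ≡⟨ ℤ.pos-* c d ⟩
  + c * + d            ∎
  where open ≡-Reasoning

modular-inverse : Prime p → p ∤ m → ∃ λ i → p ∣ℤ + m * i - 1ℤ
modular-inverse {p} {m} p-prime p∤m with coprime-Bézout (prime∤⇒coprime p-prime p∤m)
... | GCD.Bézout.+- i k 1+kp≡im = + i , ∣ℤ-multiple (+ k) ℤ∣.∣-refl (begin
  + m * + i - 1ℤ        ≡⟨ cong (_- 1ℤ) (ℤ.*-comm (+ m) (+ i)) ⟩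
  + i * + m - 1ℤ        ≡⟨ cong (_- 1ℤ) (pos-1+* k p i m 1+kp≡im) ⟨
  1ℤ + + k * + p - 1ℤ   ≡⟨ 1+z-1≡z (+ k * + p) ⟩
  + k * + p             ∎)
  where
  open ≡-Reasoning
  1+z-1≡z : ∀ z → 1ℤ + z - 1ℤ ≡ z
  1+z-1≡z = solve-∀
... | GCD.Bézout.-+ i k 1+im≡kp = - + i , ∣ℤ-multiple (- + k) ℤ∣.∣-refl (begin
  + m * - + i - 1ℤ      ≡⟨ m*-i-1≡-[1+i*m] (+ m) (+ i) ⟩
  - (1ℤ + + i * + m)    ≡⟨ cong -_ (pos-1+* i m k p 1+im≡kp) ⟩
  - (+ k * + p)         ≡⟨ ℤ.neg-distribˡ-* (+ k) (+ p) ⟩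
  - + k * + p           ∎)
  where
  open ≡-Reasoning
  m*-i-1≡-[1+i*m] : ∀ m i → m * - i - 1ℤ ≡ - (1ℤ + i * m)
  m*-i-1≡-[1+i*m] = solve-∀

linear-congruence : Prime p → ¬ p ∣ℤ x → ∀ c → ∃ λ n → p ∣ℤ x * n - c
linear-congruence {x = x} p-prime p∤x c with modular-inverse p-prime (p∤x ∘ ℤ∣.∣ᵤ⇒∣) | ℤ.+∣i∣≡i⊎+∣i∣≡-i x
... | i , p∣∣x∣i-1 | inj₁ ∣x∣≡x  = i * c , ∣ℤ-multiple c p∣∣x∣i-1 (begin
  x * (i * c) - c                ≡⟨ x[ic]-c≡c[xi-1] x i c ⟩
  c * (x * i - 1ℤ)               ≡⟨ cong (λ y → c * (y * i - 1ℤ)) ∣x∣≡x ⟨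
  c * (+ ∣ x ∣ * i - 1ℤ)         ∎)
  where
  open ≡-Reasoning
  x[ic]-c≡c[xi-1] : ∀ x i c → x * (i * c) - c ≡ c * (x * i - 1ℤ)
  x[ic]-c≡c[xi-1] = solve-∀
... | i , p∣∣x∣i-1 | inj₂ ∣x∣≡-x = - (i * c) , ∣ℤ-multiple c p∣∣x∣i-1 (begin
  x * - (i * c) - c              ≡⟨ x[-ic]-c≡c[-xi-1] x i c ⟩
  c * (- x * i - 1ℤ)             ≡⟨ cong (λ y → c * (y * i - 1ℤ)) ∣x∣≡-x ⟨
  c * (+ ∣ x ∣ * i - 1ℤ)         ∎)
  where
  open ≡-Reasoning
  x[-ic]-c≡c[-xi-1] : ∀ x i c → x * - (i * c) - c ≡ c * (- x * i - 1ℤ)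
  x[-ic]-c≡c[-xi-1] = solve-∀

-- Squares modulo an odd number

∣ℤ-difference-of-squares : ∀ x y → p ∣ℤ x - y ⊎ p ∣ℤ x + y → p ∣ℤ x * x - y * y
∣ℤ-difference-of-squares x y (inj₁ p∣x-y) = ∣ℤ-multiple (x + y) p∣x-y (x²-y²≡[x+y][x-y] x y)
  where
  x²-y²≡[x+y][x-y] : ∀ x y → x * x - y * y ≡ (x + y) * (x - y)
  x²-y²≡[x+y][x-y] = solve-∀
∣ℤ-difference-of-squares x y (inj₂ p∣x+y) = ∣ℤ-multiple (x - y) p∣x+y (x²-y²≡[x-y][x+y] x y)
  where
  x²-y²≡[x-y][x+y] : ∀ x y → x * x - y * y ≡ (x - y) * (x + y)
  x²-y²≡[x-y][x+y] = solve-∀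

-- The representative is ± (x mod p), whichever lies in [0, h].
square-representative-≤ : ∀ h x → ∃ λ y → y ℕ.≤ h × suc (2 ℕ.* h) ∣ℤ x * x - + y * + y
square-representative-≤ h x
  with x %ℕ suc (2 ℕ.* h) | a≡a%ℕn+[a/ℕn]*n x (suc (2 ℕ.* h)) | n%ℕd<d x (suc (2 ℕ.* h))
... | r | x≡r+qP | r<P with r ℕ.≤? h
... | yes r≤h = r , r≤h , ∣ℤ-difference-of-squares x (+ r) (inj₁ (ℤ∣.divides q (begin
  x - + r              ≡⟨ cong (_- + r) x≡r+qP ⟩
  + r + q * + P - + r  ≡⟨ r+z-r≡z (+ r) (q * + P) ⟩
  q * + P              ∎)))
  where
  open ≡-Reasoning
  P : ℕ
  P = suc (2 ℕ.* h)
  q : ℤ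
  q = x /ℕ P
  r+z-r≡z : ∀ r z → r + z - r ≡ z
  r+z-r≡z = solve-∀
... | no r≰h = P ∸ r , P∸r≤h , ∣ℤ-difference-of-squares x (+ (P ∸ r)) (inj₂ (ℤ∣.divides (q + 1ℤ) (begin
  x + + (P ∸ r)                ≡⟨ cong₂ _+_ x≡r+qP (sym (trans (ℤ.m-n≡m⊖n P r) (ℤ.⊖-≥ (ℕ.<⇒≤ r<P)))) ⟩
  + r + q * + P + (+ P - + r)  ≡⟨ r+qP+[P-r]≡[q+1]P (+ r) q (+ P) ⟩
  (q + 1ℤ) * + P               ∎)))
  where
  open ≡-Reasoning
  P : ℕ
  P = suc (2 ℕ.* h)
  q : ℤ
  q = x /ℕ P
  P∸r≤h : P ∸ r ℕ.≤ h
  P∸r≤h = ℕ.≤-trans (ℕ.∸-monoʳ-≤ P (ℕ.≰⇒> r≰h))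
                    (ℕ.≤-reflexive (trans (ℕ.m+n∸m≡n h (h ℕ.+ 0)) (ℕ.+-identityʳ h)))
  r+qP+[P-r]≡[q+1]P : ∀ r q P → r + q * P + (P - r) ≡ (q + 1ℤ) * P
  r+qP+[P-r]≡[q+1]P = solve-∀

square-representative : ∀ h → p ≡ suc (2 ℕ.* h) → ∀ x →
                        ∃ λ (y : Fin (suc h)) → p ∣ℤ x * x - + toℕ y * + toℕ y
square-representative h refl x with square-representative-≤ h x
... | y , y≤h , p∣x²-y² = Fin.fromℕ< (s≤s y≤h) ,
  subst (λ y → suc (2 ℕ.* h) ∣ℤ x * x - + y * + y) (sym (Fin.toℕ-fromℕ< (s≤s y≤h))) p∣x²-y²

∣ℤ-common-square : ∀ x y b → p ∣ℤ x * x - b * b → p ∣ℤ y * y - b * b → p ∣ℤ x * x - y * y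
∣ℤ-common-square x y b p∣x²-b² p∣y²-b² = ∣ℤ-combination 1ℤ -1ℤ p∣x²-b² p∣y²-b² (identity x y b)
  where
  identity : ∀ x y b → x * x - y * y ≡ 1ℤ * (x * x - b * b) + -1ℤ * (y * y - b * b)
  identity = solve-∀

∣ℤ-replace-square : ∀ r E y y′ t → p ∣ℤ y * y - y′ * y′ →
                    p ∣ℤ r + E * (y * y) - t → p ∣ℤ r + E * (y′ * y′) - t
∣ℤ-replace-square r E y y′ t p∣y²-y′² p∣r+Ey²-t =
  ∣ℤ-combination 1ℤ (- E) p∣r+Ey²-t p∣y²-y′² (identity r E y y′ t)
  where
  identity : ∀ r E y y′ t → r + E * (y′ * y′) - t ≡ 1ℤ * (r + E * (y * y) - t) + - E * (y * y - y′ * y′)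
  identity = solve-∀

-- Injections missing two points

squeeze : ∀ {c : Fin (suc n)} (f : Fin m → Fin (suc n)) → (∀ i → f i ≢ c) → Fin m → Fin n
squeeze f f≢c i = Fin.punchOut (f≢c i ∘ sym)

squeeze-injective : ∀ {c : Fin (suc n)} {f : Fin m → Fin (suc n)} (f≢c : ∀ i → f i ≢ c) →
                    Injective _≡_ _≡_ f → Injective _≡_ _≡_ (squeeze f f≢c)
squeeze-injective f≢c f-inj eq = f-inj (Fin.punchOut-injective (f≢c _ ∘ sym) (f≢c _ ∘ sym) eq)

squeeze-≢ : ∀ {c d : Fin (suc n)} {f : Fin m → Fin (suc n)} (f≢c : ∀ i → f i ≢ c) (c≢d : c ≢ d) →
            (∀ i → f i ≢ d) → ∀ i → squeeze f f≢c i ≢ Fin.punchOut c≢d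
squeeze-≢ f≢c c≢d f≢d i eq = f≢d i (Fin.punchOut-injective (f≢c i ∘ sym) c≢d eq)

injective-missing-two⇒≤ : ∀ {c d : Fin (suc (suc n))} {f : Fin m → Fin (suc (suc n))} →
                          Injective _≡_ _≡_ f → c ≢ d → (∀ i → f i ≢ c) → (∀ i → f i ≢ d) → m ℕ.≤ n
injective-missing-two⇒≤ f-inj c≢d f≢c f≢d =
  Fin.injective⇒≤ (squeeze-injective (squeeze-≢ f≢c c≢d f≢d) (squeeze-injective f≢c f-inj))

-- Residues avoiding squares

AvoidsSquares : ℕ → ℤ → ℤ → Set
AvoidsSquares p E r = ∀ y (t : Fin 2) → ¬ p ∣ℤ r + E * (y * y) - + toℕ t

avoidsSquares-two : ∀ {E} → Prime p → p ∤ 2 → p ∣ℤ E → AvoidsSquares p E (+ 2)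
avoidsSquares-two {p} {E} p-prime p∤2 p∣E y t p∣2+Ey²-t =
  p∤2-t t (∣ℤ-combination 1ℤ (- (y * y)) p∣2+Ey²-t p∣E (identity E y (+ toℕ t)))
  where
  identity : ∀ E y t → + 2 - t ≡ 1ℤ * (+ 2 + E * (y * y) - t) + - (y * y) * E
  identity = solve-∀
  p∤2-t : ∀ t → ¬ p ∣ℤ + 2 - + toℕ t
  p∤2-t 0F = p∤2 ∘ ∣ℤ⇒∣
  p∤2-t 1F = prime∤1 p-prime ∘ ∣ℤ⇒∣

module OddPrimeCovering {p h : ℕ} {E : ℤ} (p≡2h+1 : p ≡ suc (2 ℕ.* h))
                        (p-prime : Prime p) (p∤30 : p ∤ 30) (p∤E : ¬ p ∣ℤ E) where

  p∤1 : p ∤ 1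
  p∤1 = ∤-divisor p∤30 (divides 30 refl)

  p∤2 : p ∤ 2
  p∤2 = ∤-divisor p∤30 (divides 15 refl)

  p∤3 : p ∤ 3
  p∤3 = ∤-divisor p∤30 (divides 10 refl)

  -- Then 1 − E b² ≡ −E a², so this residue is covered both with shift 0 and with shift 1.
  CollidingSquare : ℤ → Set
  CollidingSquare b = ∃ λ a → p ∣ℤ E * (b * b - a * a) - 1ℤ

  GapSolution : ℤ → ℤ → Set
  GapSolution d x = p ∣ℤ E * (x * x - (x - d) * (x - d)) - 1ℤ

  gap-solution : ∀ d → p ∤ d → ∃ (GapSolution (+ d))
  gap-solution d p∤d with linear-congruence p-prime p∤2Ed (1ℤ + E * (+ d * + d))
    where
    p∤2Ed : ¬ p ∣ℤ + 2 * E * + d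
    p∤2Ed = prime∤*⇒∤ p-prime (prime∤*⇒∤ p-prime (p∤2 ∘ ∣ℤ⇒∣) p∤E) (p∤d ∘ ∣ℤ⇒∣)
  ... | x , p∣2Edx-[1+Ed²] = x , ∣ℤ-multiple 1ℤ p∣2Edx-[1+Ed²] (identity E (+ d) x)
    where
    identity : ∀ E d x → E * (x * x - (x - d) * (x - d)) - 1ℤ ≡ 1ℤ * (+ 2 * E * d * x - (1ℤ + E * (d * d)))
    identity = solve-∀

  gap-solution-collides : ∀ d x → GapSolution d x → CollidingSquare x
  gap-solution-collides d x s = x - d , s

  colliding-representative : ∀ x b → CollidingSquare x → p ∣ℤ x * x - b * b → CollidingSquare b
  colliding-representative x b (a , p∣E[x²-a²]-1) p∣x²-b² =
    a , ∣ℤ-combination 1ℤ (- E) p∣E[x²-a²]-1 p∣x²-b² (identity E x b a)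
    where
    identity : ∀ E x b a → E * (b * b - a * a) - 1ℤ ≡ 1ℤ * (E * (x * x - a * a) - 1ℤ) + - E * (x * x - b * b)
    identity = solve-∀

  -- The solution for the gap d is x = (d + 1/(E d))/2, and x_d ≡ ± x_d′ forces d ≡ ± d′ or E d d′ ≡ ± 1.
  gap-solutions-collide : ∀ d d′ x x′ → GapSolution d x → GapSolution d′ x′ →
    p ∣ℤ x * x - x′ * x′ → p ∣ℤ (d * d - d′ * d′) * (E * E * d * d * d′ * d′ - 1ℤ)
  gap-solutions-collide d d′ x x′ s s′ p∣x²-x′² =
    ∣ℤ-combination₃ (+ 4 * E * E * d * d * d′ * d′) (d′ * d′ * defect d x - + 4 * E * d * d′ * d′ * x)
                    (+ 4 * E * d * d * d′ * x′ - d * d * defect d′ x′) p∣x²-x′² s s′ (identity E d d′ x x′)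
    where
    defect : ℤ → ℤ → ℤ
    defect d x = E * (x * x - (x - d) * (x - d)) - 1ℤ
    identity : ∀ E d d′ x x′ →
      (d * d - d′ * d′) * (E * E * d * d * d′ * d′ - 1ℤ)
        ≡ + 4 * E * E * d * d * d′ * d′ * (x * x - x′ * x′)
          + (d′ * d′ * (E * (x * x - (x - d) * (x - d)) - 1ℤ) - + 4 * E * d * d′ * d′ * x)
            * (E * (x * x - (x - d) * (x - d)) - 1ℤ)
          + (+ 4 * E * d * d * d′ * x′ - d * d * (E * (x′ * x′ - (x′ - d′) * (x′ - d′)) - 1ℤ))
            * (E * (x′ * x′ - (x′ - d′) * (x′ - d′)) - 1ℤ)
    identity = solve-∀

  no-triple-gap-collision : ∀ x₁ x₂ x₃ → GapSolution (+ 1) x₁ → GapSolution (+ 2) x₂ → GapSolution (+ 3) x₃ →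
    p ∣ℤ x₁ * x₁ - x₂ * x₂ → p ∣ℤ x₁ * x₁ - x₃ * x₃ → ⊥
  no-triple-gap-collision x₁ x₂ x₃ s₁ s₂ s₃ p∣x₁²-x₂² p∣x₁²-x₃² =
    p∤30 (∣-trans (∣ℤ⇒∣ (∣ℤ-combination (+ 6) -1ℤ
      (gap-solutions-collide (+ 1) (+ 2) x₁ x₂ s₁ s₂ p∣x₁²-x₂²)
      (gap-solutions-collide (+ 1) (+ 3) x₁ x₃ s₁ s₃ p∣x₁²-x₃²) (identity E))) (divides 3 refl))
    where
    identity : ∀ E → + 10 ≡ + 6 * ((+ 1 * + 1 - + 2 * + 2) * (E * E * + 1 * + 1 * + 2 * + 2 - 1ℤ))
                           + -1ℤ * ((+ 1 * + 1 - + 3 * + 3) * (E * E * + 1 * + 1 * + 3 * + 3 - 1ℤ))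
    identity = solve-∀

  TwoCollidingSquares : Set
  TwoCollidingSquares =
    ∃₂ λ (b b′ : Fin (suc h)) → b ≢ b′ × CollidingSquare (+ toℕ b) × CollidingSquare (+ toℕ b′)

  Representative : ℤ → Set
  Representative x = ∃ λ (b : Fin (suc h)) → p ∣ℤ x * x - + toℕ b * + toℕ b

  two-colliding-representatives : ∀ x₁ x₂ x₃ →
    GapSolution (+ 1) x₁ → GapSolution (+ 2) x₂ → GapSolution (+ 3) x₃ →
    Representative x₁ → Representative x₂ → Representative x₃ → TwoCollidingSquares
  two-colliding-representatives x₁ x₂ x₃ s₁ s₂ s₃ (b₁ , x₁~b₁) (b₂ , x₂~b₂) (b₃ , x₃~b₃)
    with b₁ Fin.≟ b₂ | b₁ Fin.≟ b₃
  ... | no b₁≢b₂ | _ = b₁ , b₂ , b₁≢b₂ ,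
    colliding-representative x₁ (+ toℕ b₁) (gap-solution-collides (+ 1) x₁ s₁) x₁~b₁ ,
    colliding-representative x₂ (+ toℕ b₂) (gap-solution-collides (+ 2) x₂ s₂) x₂~b₂
  ... | yes _ | no b₁≢b₃ = b₁ , b₃ , b₁≢b₃ ,
    colliding-representative x₁ (+ toℕ b₁) (gap-solution-collides (+ 1) x₁ s₁) x₁~b₁ ,
    colliding-representative x₃ (+ toℕ b₃) (gap-solution-collides (+ 3) x₃ s₃) x₃~b₃
  ... | yes refl | yes refl = ⊥-elim (no-triple-gap-collision x₁ x₂ x₃ s₁ s₂ s₃
    (∣ℤ-common-square x₁ x₂ (+ toℕ b₁) x₁~b₁ x₂~b₂) (∣ℤ-common-square x₁ x₃ (+ toℕ b₁) x₁~b₁ x₃~b₃))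

  two-colliding-squares : TwoCollidingSquares
  two-colliding-squares = from-solutions (gap-solution 1 p∤1) (gap-solution 2 p∤2) (gap-solution 3 p∤3)
    where
    from-solutions : ∃ (GapSolution (+ 1)) → ∃ (GapSolution (+ 2)) → ∃ (GapSolution (+ 3)) → TwoCollidingSquares
    from-solutions (x₁ , s₁) (x₂ , s₂) (x₃ , s₃) = two-colliding-representatives x₁ x₂ x₃ s₁ s₂ s₃
      (square-representative h p≡2h+1 x₁) (square-representative h p≡2h+1 x₂)
      (square-representative h p≡2h+1 x₃)

  Covers : Fin p → Fin (suc h) → Fin 2 → Set
  Covers r y t = p ∣ℤ + toℕ r + E * (+ toℕ y * + toℕ y) - + toℕ t

  Covered : Fin p → Set
  Covered r = ∃₂ (Covers r)

  covered? : ∀ r → Dec (Covered r)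
  covered? r = Fin.any? λ y → Fin.any? λ t → + p ℤ∣.∣? + toℕ r + E * (+ toℕ y * + toℕ y) - + toℕ t

  covers-injective : ∀ r r′ y t → Covers r y t → Covers r′ y t → r ≡ r′
  covers-injective r r′ y t c c′ =
    ∣ℤ-toℕ-toℕ⇒≡ r r′ (subst (p ∣ℤ_) (identity (+ toℕ r) (+ toℕ r′) Ey² (+ toℕ t)) (ℤ∣.∣m∣n⇒∣m-n c c′))
    where
    Ey² : ℤ
    Ey² = E * (+ toℕ y * + toℕ y)
    identity : ∀ r r′ Ey² t → r + Ey² - t - (r′ + Ey² - t) ≡ r - r′
    identity = solve-∀

  -- Shift 1 is only used when shift 0 is impossible.
  record PreferredCover (r : Fin p) : Set where
    field
      root    : Fin (suc h)
      shift   : Fin 2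
      covers  : Covers r root shift
      minimal : shift ≡ 1F → ∀ y → ¬ Covers r y 0F

  preferred-cover : ∀ r → Covered r → PreferredCover r
  preferred-cover r (y , t , c) with Fin.any? (λ y′ → + p ℤ∣.∣? + toℕ r + E * (+ toℕ y′ * + toℕ y′) - 0ℤ)
  ... | yes (y′ , c′) = record { root = y′ ; shift = 0F ; covers = c′ ; minimal = λ () }
  ... | no ¬c₀        = record { root = y ; shift = t ; covers = c ; minimal = λ _ y′ c₀ → ¬c₀ (y′ , c₀) }

  colliding⇒shift-0-cover : ∀ r b → CollidingSquare (+ toℕ b) → Covers r b 1F → ∃ λ y → Covers r y 0F
  colliding⇒shift-0-cover r b (a , p∣E[b²-a²]-1) c = replace (square-representative h p≡2h+1 a)
    where
    identity : ∀ r E b a → r + E * (a * a) - 0ℤ ≡ 1ℤ * (r + E * (b * b) - 1ℤ) + -1ℤ * (E * (b * b - a * a) - 1ℤ)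
    identity = solve-∀
    replace : Representative a → ∃ λ y → Covers r y 0F
    replace (a′ , a~a′) = a′ , ∣ℤ-replace-square (+ toℕ r) E a (+ toℕ a′) 0ℤ a~a′
      (∣ℤ-combination 1ℤ -1ℤ c p∣E[b²-a²]-1 (identity (+ toℕ r) E (+ toℕ b) a))

  module _ (all-covered : ∀ r → Covered r) where
    open PreferredCover

    code : Fin p → Fin (suc h ℕ.* 2)
    code r = Fin.combine (root C) (shift C)
      where
      C : PreferredCover r
      C = preferred-cover r (all-covered r)

    code-injective : Injective _≡_ _≡_ code
    code-injective {r} {r′} eq =
      covers-injective r r′ (root C) (shift C) (covers C)
        (subst₂ (Covers r′) (sym root≡) (sym shift≡) (covers C′))
      where
      C : PreferredCover r
      C = preferred-cover r (all-covered r)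
      C′ : PreferredCover r′
      C′ = preferred-cover r′ (all-covered r′)
      root≡ : root C ≡ root C′
      root≡ = proj₁ (Fin.combine-injective (root C) (shift C) (root C′) (shift C′) eq)
      shift≡ : shift C ≡ shift C′
      shift≡ = proj₂ (Fin.combine-injective (root C) (shift C) (root C′) (shift C′) eq)

    code-misses : ∀ b → CollidingSquare (+ toℕ b) → ∀ r → code r ≢ Fin.combine b 1F
    code-misses b colliding r eq =
      uncurry (minimal C shift≡1)
        (colliding⇒shift-0-cover r b colliding (subst₂ (Covers r) root≡b shift≡1 (covers C)))
      where
      C : PreferredCover r
      C = preferred-cover r (all-covered r)
      root≡b : root C ≡ b
      root≡b = proj₁ (Fin.combine-injective (root C) (shift C) b 1F eq)
      shift≡1 : shift C ≡ 1F
      shift≡1 = proj₂ (Fin.combine-injective (root C) (shift C) b 1F eq)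

  not-all-covered : ¬ (∀ r → Covered r)
  not-all-covered all-covered = refute two-colliding-squares
    where
    refute : TwoCollidingSquares → ⊥
    refute (b , b′ , b≢b′ , colliding , colliding′) = ℕ.1+n≰n (subst₂ ℕ._≤_ p≡2h+1 (ℕ.*-comm h 2)
      (injective-missing-two⇒≤ {c = Fin.combine b 1F} {d = Fin.combine b′ 1F} {f = code all-covered}
        (code-injective all-covered) (b≢b′ ∘ proj₁ ∘ Fin.combine-injective b 1F b′ 1F)
        (code-misses all-covered b colliding) (code-misses all-covered b′ colliding′)))

  uncovered⇒avoidsSquares : ∀ r → ¬ Covered r → AvoidsSquares p E (+ toℕ r)
  uncovered⇒avoidsSquares r uncovered y t p∣r+Ey²-t = uncovered (replace (square-representative h p≡2h+1 y))
    where
    replace : Representative y → Covered r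
    replace (y′ , y~y′) = y′ , t , ∣ℤ-replace-square (+ toℕ r) E y (+ toℕ y′) (+ toℕ t) y~y′ p∣r+Ey²-t

  avoiding-residue : ∃ (AvoidsSquares p E)
  avoiding-residue = residue (Fin.¬∀⟶∃¬ p Covered covered? not-all-covered)
    where
    residue : (∃ λ r → ¬ Covered r) → ∃ (AvoidsSquares p E)
    residue (r , uncovered) = + toℕ r , uncovered⇒avoidsSquares r uncovered

avoidsSquares-exists : ∀ {E} → Prime p → p ∤ 30 → ¬ p ∣ℤ E → ∃ (AvoidsSquares p E)
avoidsSquares-exists {E = E} p-prime p∤30 p∤E with prime∤2⇒odd p-prime (∤-divisor p∤30 (divides 15 refl))
... | h , p≡2h+1 = OddPrimeCovering.avoiding-residue {h = h} {E = E} p≡2h+1 p-prime p∤30 p∤E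

-- The construction

increasing⇒injective : {f : Fin n → ℤ} → (∀ {i j} → i Fin.< j → f i < f j) → Injective _≡_ _≡_ f
increasing⇒injective f-increasing {i} {j} fi≡fj with Fin.<-cmp i j
... | tri< i<j _ _ = ⊥-elim (ℤ.<-irrefl fi≡fj (f-increasing i<j))
... | tri≈ _ i≡j _ = i≡j
... | tri> _ _ j<i = ⊥-elim (ℤ.<-irrefl (sym fi≡fj) (f-increasing j<i))

prime∤productℤ-evals : Prime p → ∀ {Ls n} → All (λ L → ¬ p ∣ℤ eval L n) Ls →
                       ¬ (+ p) ℤD.∣ productℤ (List.map (λ L → eval L n) Ls)
prime∤productℤ-evals p-prime p∤Ls = prime∤productℤ p-prime (All.map⁺ p∤Ls) ∘ ℤ∣.∣ᵤ⇒∣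

∣ℤ-eval-at-0 : ∀ c z k → p ∣ c → p ∣ℤ eval (+ c , z + + (c ℕ.* k)) 0ℤ → p ∣ℤ z
∣ℤ-eval-at-0 c z k p∣c p∣value =
  ∣ℤ-combination 1ℤ -1ℤ p∣value (∣⇒∣ℤ (∣-trans p∣c (m∣m*n k))) (identity (+ c) z (+ (c ℕ.* k)))
  where
  identity : ∀ c z x → z ≡ 1ℤ * (c * 0ℤ + (z + x)) + -1ℤ * x
  identity = solve-∀

-- The factor 5 makes the prime 5 harmless: it then divides E = 5 v, see avoidsSquares-two.
offset : ∀ {κ} → Fin κ → ℕ
offset i = 5 ℕ.* (toℕ i ℕ.* toℕ i)

offset-increasing : ∀ {κ} {i j : Fin κ} → i Fin.< j → offset i ℕ.< offset j
offset-increasing i<j = ℕ.*-monoʳ-< 5 (ℕ.*-mono-< i<j i<j)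

shifted-offset-increasing : ∀ {κ} z c → 0 ℕ.< c → {i j : Fin κ} → i Fin.< j →
                            z + + (c ℕ.* offset i) < z + + (c ℕ.* offset j)
shifted-offset-increasing z c 0<c i<j =
  ℤ.+-monoʳ-< z (ℤ.+<+ (ℕ.*-monoʳ-< c {{ℕ.>-nonZero 0<c}} (offset-increasing i<j)))

offset≤[2κ]³ : ∀ {κ} (i : Fin κ) → offset i ℕ.≤ (2 ℕ.* κ) ^ 3
offset≤[2κ]³ {suc κ} i = begin
  5 ℕ.* (toℕ i ℕ.* toℕ i)            ≤⟨ ℕ.*-mono-≤ {5} {8} 5≤8 (ℕ.*-mono-≤ i≤κ i≤κ) ⟩
  8 ℕ.* (suc κ ℕ.* suc κ)            ≤⟨ ℕ.m≤m*n (8 ℕ.* (suc κ ℕ.* suc κ)) (suc κ) ⟩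
  8 ℕ.* (suc κ ℕ.* suc κ) ℕ.* suc κ  ≡⟨ 8k²k≡[2k]³ (suc κ) ⟩
  (2 ℕ.* suc κ) ^ 3                  ∎
  where
  open ℕ.≤-Reasoning
  5≤8 : 5 ℕ.≤ 8
  5≤8 = s≤s (s≤s (s≤s (s≤s (s≤s z≤n))))
  i≤κ : toℕ i ℕ.≤ suc κ
  i≤κ = ℕ.<⇒≤ (Fin.toℕ<n i)
  8k²k≡[2k]³ : ∀ k → 8 ℕ.* (k ℕ.* k) ℕ.* k ≡ 2 ℕ.* k ℕ.* (2 ℕ.* k ℕ.* (2 ℕ.* k ℕ.* 1))
  8k²k≡[2k]³ = ℕ-solve-∀

pos-c*offset : ∀ c {κ} (i : Fin κ) → + (c ℕ.* offset i) ≡ + 5 * + c * (+ toℕ i * + toℕ i)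
pos-c*offset c i = begin
  + (c ℕ.* (5 ℕ.* (toℕ i ℕ.* toℕ i)))       ≡⟨ ℤ.pos-* c (offset i) ⟩
  + c * + (5 ℕ.* (toℕ i ℕ.* toℕ i))         ≡⟨ cong (λ z → + c * z) (ℤ.pos-* 5 (toℕ i ℕ.* toℕ i)) ⟩
  + c * (+ 5 * + (toℕ i ℕ.* toℕ i))         ≡⟨ cong (λ z → + c * (+ 5 * z)) (ℤ.pos-* (toℕ i) (toℕ i)) ⟩
  + c * (+ 5 * (+ toℕ i * + toℕ i))         ≡⟨ c[5y²]≡5cy² (+ c) (+ toℕ i) ⟩
  + 5 * + c * (+ toℕ i * + toℕ i)           ∎
  where
  open ≡-Reasoning
  c[5y²]≡5cy² : ∀ c y → c * (+ 5 * (y * y)) ≡ + 5 * c * (y * y)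
  c[5y²]≡5cy² = solve-∀

module Construction
  (v T W : ℕ) .{{_ : NonZero T}} (u q : ℤ) (κ : ℕ)
  (0<v : 0 ℕ.< v) (v≡T*W : v ≡ T ℕ.* W) (1<T : 1 ℕ.< T) (6∣v : 6 ∣ v)
  (∣v⇒∣W : ∀ {p} → Prime p → p ∣ v → p ∣ W)
  (u-1≡qT : u - 1ℤ ≡ q * + T) (u⊥v : Coprime ∣ u ∣ v) (q⊥v : Coprime ∣ q ∣ v)
  where

  E : ℤ
  E = + 5 * + v

  a b : Fin κ → ℤ
  a i = u + + (v ℕ.* offset i)
  b i = q + + (W ℕ.* offset i)

  L L̃ : Fin κ → LinFun
  L i = + v , a i
  L̃ i = + W , b i

  0<W : 0 ℕ.< W
  0<W = ℕ.n≢0⇒n>0 λ W≡0 → ℕ.<⇒≢ 0<v (sym (trans v≡T*W (trans (cong (T ℕ.*_) W≡0) (ℕ.*-zeroʳ T))))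

  W<v : W ℕ.< v
  W<v = subst (W ℕ.<_) (trans (ℕ.*-comm W T) (sym v≡T*W)) (ℕ.m<m*n W T {{ℕ.>-nonZero 0<W}} 1<T)

  +v≡T*W : + v ≡ + T * + W
  +v≡T*W = trans (cong +_ v≡T*W) (ℤ.pos-* T W)

  u≡qT+1 : u ≡ q * + T + 1ℤ
  u≡qT+1 = trans (z≡z-1+1 u) (cong (_+ 1ℤ) u-1≡qT)
    where
    z≡z-1+1 : ∀ z → z ≡ z - 1ℤ + 1ℤ
    z≡z-1+1 = solve-∀

  a-1≡b*T : ∀ i → a i - 1ℤ ≡ b i * + T
  a-1≡b*T i = begin
    u + + (v ℕ.* offset i) - 1ℤ                  ≡⟨ cong₂ (λ u z → u + z - 1ℤ) u≡qT+1 (pos-c*offset v i) ⟩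
    q * + T + 1ℤ + + 5 * + v * Y - 1ℤ            ≡⟨ cong (λ V → q * + T + 1ℤ + + 5 * V * Y - 1ℤ) +v≡T*W ⟩
    q * + T + 1ℤ + + 5 * (+ T * + W) * Y - 1ℤ    ≡⟨ identity q (+ T) (+ W) Y ⟩
    (q + + 5 * + W * Y) * + T                    ≡⟨ cong (λ z → (q + z) * + T) (pos-c*offset W i) ⟨
    b i * + T                                    ∎
    where
    open ≡-Reasoning
    Y : ℤ
    Y = + toℕ i * + toℕ i
    identity : ∀ q T W Y → q * T + 1ℤ + + 5 * (T * W) * Y - 1ℤ ≡ (q + + 5 * W * Y) * T
    identity = solve-∀

  T*L̃≡L-1 : ∀ i n → + T * eval (L̃ i) n ≡ eval (L i) n - 1ℤ
  T*L̃≡L-1 i n = begin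
    + T * (+ W * n + b i)                ≡⟨ identity (+ T) (+ W) n (b i) ⟩
    + T * + W * n + b i * + T            ≡⟨ cong₂ (λ V z → V * n + z) +v≡T*W (a-1≡b*T i) ⟨
    + v * n + (a i - 1ℤ)                 ≡⟨ ℤ.+-assoc (+ v * n) (a i) -1ℤ ⟨
    + v * n + a i - 1ℤ                   ∎
    where
    open ≡-Reasoning
    identity : ∀ T W n b → T * (W * n + b) ≡ T * W * n + b * T
    identity = solve-∀

  ∣ℤ-L-t⇒∣ℤ-r+Ei²-t : ∀ {p r n} i t → p ∣ℤ + v * n - (r - u) → p ∣ℤ eval (L i) n - t →
                       p ∣ℤ r + E * (+ toℕ i * + toℕ i) - t
  ∣ℤ-L-t⇒∣ℤ-r+Ei²-t {p} {r} {n} i t p∣vn-[r-u] p∣L-t =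
    ∣ℤ-combination 1ℤ -1ℤ (subst (λ z → p ∣ℤ + v * n + (u + z) - t) (pos-c*offset v i) p∣L-t) p∣vn-[r-u]
                   (identity (+ v) n u r (+ toℕ i) t)
    where
    identity : ∀ v n u r y t → r + + 5 * v * (y * y) - t
                               ≡ 1ℤ * (v * n + (u + + 5 * v * (y * y)) - t) + -1ℤ * (v * n - (r - u))
    identity = solve-∀

  module _ {p} (p-prime : Prime p) where

    nondivisible-at-0 : p ∣ v → ∀ i → ¬ p ∣ℤ eval (L i) 0ℤ × ¬ p ∣ℤ eval (L̃ i) 0ℤ
    nondivisible-at-0 p∣v i =
      (λ p∣L → coprime⇒∤ u⊥v p-prime p∣v (ℤ∣.∣⇒∣ᵤ (∣ℤ-eval-at-0 v u (offset i) p∣v p∣L))) ,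
      (λ p∣L̃ → coprime⇒∤ q⊥v p-prime p∣v (ℤ∣.∣⇒∣ᵤ (∣ℤ-eval-at-0 W q (offset i) (∣v⇒∣W p-prime p∣v) p∣L̃)))

    nondivisible-at-preimage : ∀ {r n} → AvoidsSquares p E r → p ∣ℤ + v * n - (r - u) →
                               ∀ i → ¬ p ∣ℤ eval (L i) n × ¬ p ∣ℤ eval (L̃ i) n
    nondivisible-at-preimage {r} {n} avoids p∣vn-[r-u] i =
      (λ p∣L → avoids (+ toℕ i) 0F (∣ℤ-L-t⇒∣ℤ-r+Ei²-t {p} {r} {n} i 0ℤ p∣vn-[r-u]
        (subst (p ∣ℤ_) (sym (ℤ.+-identityʳ (eval (L i) n))) p∣L))) ,
      (λ p∣L̃ → avoids (+ toℕ i) 1F (∣ℤ-L-t⇒∣ℤ-r+Ei²-t {p} {r} {n} i 1ℤ p∣vn-[r-u]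
        (subst (p ∣ℤ_) (T*L̃≡L-1 i n) (ℤ∣.∣n⇒∣m*n (+ T) p∣L̃))))

    avoiding-residue : p ∤ v → ∃ (AvoidsSquares p E)
    avoiding-residue p∤v with + p ℤ∣.∣? E
    ... | yes p∣E = + 2 , avoidsSquares-two p-prime (∤-divisor p∤v (∣-trans (divides 3 refl) 6∣v)) p∣E
    ... | no  p∤E = avoidsSquares-exists p-prime (p∤E ∘ ∣30⇒∣E) p∤E
      where
      ∣30⇒∣E : p ∣ 30 → p ∣ℤ E
      ∣30⇒∣E p∣30 = subst (p ∣ℤ_) (ℤ.pos-* 5 v) (∣⇒∣ℤ (∣-trans p∣30 (*-monoʳ-∣ 5 6∣v)))

    nondivisible-point : ∃ λ n → ∀ i → ¬ p ∣ℤ eval (L i) n × ¬ p ∣ℤ eval (L̃ i) n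
    nondivisible-point with p ∣? v
    ... | yes p∣v = 0ℤ , nondivisible-at-0 p∣v
    ... | no  p∤v = uncurry point (avoiding-residue p∤v)
      where
      point : ∀ r → AvoidsSquares p E r → ∃ λ n → ∀ i → ¬ p ∣ℤ eval (L i) n × ¬ p ∣ℤ eval (L̃ i) n
      point r avoids =
        map₂ (nondivisible-at-preimage {r} avoids) (linear-congruence p-prime (p∤v ∘ ∣ℤ⇒∣) (r - u))

  pairs : List LinFun
  pairs = List.tabulate L ++ List.tabulate L̃

  pairs-unique : Unique pairs
  pairs-unique = Unique.++⁺
    (Unique.tabulate⁺ (increasing⇒injective (shifted-offset-increasing u v 0<v) ∘ cong proj₂))
    (Unique.tabulate⁺ (increasing⇒injective (shifted-offset-increasing q W 0<W) ∘ cong proj₂))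
    disjoint
    where
    disjoint : ∀ {ℓ} → ¬ (ℓ ∈ List.tabulate L × ℓ ∈ List.tabulate L̃)
    disjoint (ℓ∈L , ℓ∈L̃) with Any.tabulate⁻ ℓ∈L | Any.tabulate⁻ ℓ∈L̃
    ... | _ , refl | _ , L≡L̃ = ℕ.<⇒≢ W<v (sym (ℤ.+-injective (cong proj₁ L≡L̃)))

  pairs-admissible : Admissible pairs
  pairs-admissible =
    pairs-unique ,
    All.++⁺ (All.tabulate⁺ {f = L} λ _ → ℤ.+<+ 0<v) (All.tabulate⁺ {f = L̃} λ _ → ℤ.+<+ 0<W) ,
    λ p p-prime → map₂ (λ p∤ → prime∤productℤ-evals p-prime
      (All.++⁺ (All.tabulate⁺ {f = L} (proj₁ ∘ p∤)) (All.tabulate⁺ {f = L̃} (proj₂ ∘ p∤))))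
      (nondivisible-point p-prime)

  family≡pairs : family v T κ a ≡ pairs
  family≡pairs = cong (List.tabulate L ++_) (List.tabulate-cong λ i → cong₂ _,_ (cong +_ v/T≡W) (a-1/T≡b i))
    where
    v/T≡W : v ℕ./ T ≡ W
    v/T≡W = trans (cong (ℕ._/ T) (trans v≡T*W (ℕ.*-comm T W))) (m*n/n≡m W T)
    a-1/T≡b : ∀ i → (a i - 1ℤ) /ℕ T ≡ b i
    a-1/T≡b i = trans (cong (_/ℕ T) (a-1≡b*T i)) (*-/ℕ-cancel (b i) T)

  a-increasing : ∀ i j → i Fin.< j → a i < a j
  a-increasing _ _ = shifted-offset-increasing u v 0<v

  a≡u : ∀ i → a i ≡ u [mod v ]
  a≡u i = subst (λ z → v ∣ ∣ z ∣) (sym (u+x-u≡x u (+ (v ℕ.* offset i)))) (m∣m*n (offset i))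
    where
    u+x-u≡x : ∀ u x → u + x - u ≡ x
    u+x-u≡x = solve-∀

  family-admissible : Admissible (family v T κ a)
  family-admissible = subst Admissible (sym family≡pairs) pairs-admissible

  a-spread : ∀ i j → a j - a i ≤ + (v ℕ.* ((2 ℕ.* κ) ^ 3))
  a-spread i j = begin
    a j - a i                                  ≡⟨ [u+x]-[u+y]≡x-y u (+ (v ℕ.* offset j)) (+ (v ℕ.* offset i)) ⟩
    + (v ℕ.* offset j) - + (v ℕ.* offset i)    ≤⟨ ℤ.i-j≤i (+ (v ℕ.* offset j)) (+ (v ℕ.* offset i)) ⟩
    + (v ℕ.* offset j)                         ≤⟨ ℤ.+≤+ (ℕ.*-monoʳ-≤ v (offset≤[2κ]³ j)) ⟩
    + (v ℕ.* ((2 ℕ.* κ) ^ 3))                  ∎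
    where
    open ℤ.≤-Reasoning
    [u+x]-[u+y]≡x-y : ∀ u x y → u + x - (u + y) ≡ x - y
    [u+x]-[u+y]≡x-y = solve-∀

-- The modulus v

oddRad-positive : ∀ f → 0 ℕ.< oddRad f
oddRad-positive f = productOfPrimes≥1 (All.map proj₁
  (All.all-filter (λ ℓ → prime? ℓ ×-dec (ℓ ∣? f) ×-dec (4 ℕ.≤? ℓ)) (List.upTo (suc f))))

modulusV-positive : ∀ f → 0 ℕ.< modulusV f
modulusV-positive f = ℕ.≤-trans (oddRad-positive f) (ℕ.m≤n*m (oddRad f) 432)

6∣modulusV : ∀ f → 6 ∣ modulusV f
6∣modulusV f = ∣m⇒∣m*n (oddRad f) (divides 72 refl)

modulusV-split : ∀ f {T} → T ≡ 2 ⊎ T ≡ 4 ⊎ T ≡ 8 → ∃ λ W → modulusV f ≡ T ℕ.* W × 2 ∣ W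
modulusV-split f (inj₁ refl) =
  216 ℕ.* oddRad f , ℕ.*-assoc 2 216 (oddRad f) , ∣m⇒∣m*n (oddRad f) (divides 108 refl)
modulusV-split f (inj₂ (inj₁ refl)) =
  108 ℕ.* oddRad f , ℕ.*-assoc 4 108 (oddRad f) , ∣m⇒∣m*n (oddRad f) (divides 54 refl)
modulusV-split f (inj₂ (inj₂ refl)) =
  54 ℕ.* oddRad f , ℕ.*-assoc 8 54 (oddRad f) , ∣m⇒∣m*n (oddRad f) (divides 27 refl)

∈2-4-8⇒∣2³ : ∀ {T} → T ≡ 2 ⊎ T ≡ 4 ⊎ T ≡ 8 → T ∣ 2 ^ 3
∈2-4-8⇒∣2³ (inj₁ refl)        = divides 4 refl
∈2-4-8⇒∣2³ (inj₂ (inj₁ refl)) = divides 2 refl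
∈2-4-8⇒∣2³ (inj₂ (inj₂ refl)) = divides 1 refl

∈2-4-8⇒1< : ∀ {T} → T ≡ 2 ⊎ T ≡ 4 ⊎ T ≡ 8 → 1 ℕ.< T
∈2-4-8⇒1< (inj₁ refl)        = s≤s (s≤s z≤n)
∈2-4-8⇒1< (inj₂ (inj₁ refl)) = s≤s (s≤s z≤n)
∈2-4-8⇒1< (inj₂ (inj₂ refl)) = s≤s (s≤s z≤n)

lemma4p5 : ∃ λ (C₅ : ℕ) → 0 ℕ.< C₅ ×
    (∀ (f : ℕ) → 1 ℕ.≤ f →
    ∀ (u : ℤ) → Coprime ∣ u ∣ (modulusV f) →
    ∀ (T : ℕ) .{{_ : NonZero T}} → (T ≡ 2 ⊎ T ≡ 4 ⊎ T ≡ 8) →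
    (+ T) ℤD.∣ (u - 1ℤ) → ¬ ((+ (2 ℕ.* T)) ℤD.∣ (u - 1ℤ)) →
    Coprime ∣ (u - 1ℤ) /ℕ T ∣ (modulusV f) →
    ∀ (κ : ℕ) →
    ∃ λ (a : Fin κ → ℤ) →
    (∀ i j → i Fin.< j → a i < a j)
    × (∀ i → a i ≡ u [mod modulusV f ])
    × Admissible (family (modulusV f) T κ a)
    × (∀ i j → a j - a i ≤ + (modulusV f ℕ.* ((2 ℕ.* κ) ^ C₅))))
lemma4p5 = 3 , s≤s z≤n , λ f _ u u⊥v T T∈ T∣u-1 _ q⊥v κ →
  let W , v≡T*W , 2∣W = modulusV-split f T∈
      open Construction (modulusV f) T W u ((u - 1ℤ) /ℕ T) κ (modulusV-positive f) v≡T*W (∈2-4-8⇒1< T∈)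
             (6∣modulusV f) (prime∣⇒∣cofactor {k = 3} v≡T*W (∈2-4-8⇒∣2³ T∈) 2∣W)
             (/ℕ-exact (u - 1ℤ) T (ℤ∣.∣ᵤ⇒∣ T∣u-1)) u⊥v q⊥v
  in a , a-increasing , a≡u , family-admissible , a-spread
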